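{- Let $q$ be a prime power. For every squarefree polynomial $Q\in\mathbb{F}_q[z]$ of degree $n>1$, $$\omega(Q)\le 4\,\frac{n}{\log n}\log q,$$ where $\omega(Q)$ is the number of distinct monic irreducible polynomials dividing $Q$. -}

module Defs where

open import Level using (Level; _⊔_)
open import Data.Nat as ℕ using (ℕ; zero; suc; _<_)
open import Data.Fin using (Fin)
open import Data.List using (List; []; _∷_)
open import Data.Product using (Σ; ∃; _×_; _,_)
open import Data.Sum using (_⊎_)
open import Relation.Binary.PropositionalEquality using (_≡_)
open import Relation.Nullary using (¬_)
open import Algebra.Bundles using (CommutativeRing)

record Field (c ℓ : Level) : Set (Level.suc (c ⊔ ℓ)) where
  field
    commRing : CommutativeRing c ℓ
  open CommutativeRing commRing public
  field
    0≉1     : ¬ (0# ≈ 1#)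
    inverse : ∀ x → ¬ (x ≈ 0#) → ∃ λ y → (x * y) ≈ 1#

record HasCardinality {c ℓ} (F : Field c ℓ) (q : ℕ) : Set (c ⊔ ℓ) where
  open Field F
  field
    enum       : Fin q → Carrier
    enum-inj   : ∀ i j → enum i ≈ enum j → i ≡ j
    enum-surj  : ∀ x → ∃ λ i → enum i ≈ x

-- Univariate polynomials over F, as coefficient lists (constant term first).
-- Trailing zeros are allowed; polynomial equality is coefficientwise ≈.
module Poly {c ℓ} (F : Field c ℓ) where
  open Field F

  Pol : Set c
  Pol = List Carrier

  coeff : Pol → ℕ → Carrier
  coeff []       _       = 0#
  coeff (a ∷ p)  zero    = a
  coeff (a ∷ p)  (suc i) = coeff p i

  infix 4 _≃_
  _≃_ : Pol → Pol → Set ℓ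
  p ≃ r = ∀ i → coeff p i ≈ coeff r i

  infixl 6 _⊕_
  _⊕_ : Pol → Pol → Pol
  []      ⊕ r       = r
  (a ∷ p) ⊕ []      = a ∷ p
  (a ∷ p) ⊕ (b ∷ r) = (a + b) ∷ (p ⊕ r)

  scale : Carrier → Pol → Pol
  scale a []      = []
  scale a (b ∷ p) = (a * b) ∷ scale a p

  infixl 7 _⊗_
  _⊗_ : Pol → Pol → Pol
  []      ⊗ r = []
  (a ∷ p) ⊗ r = scale a r ⊕ (0# ∷ (p ⊗ r))

  infix 4 _∣ₚ_
  _∣ₚ_ : Pol → Pol → Set (c ⊔ ℓ)
  p ∣ₚ r = ∃ λ s → r ≃ p ⊗ s

  HasDegree : Pol → ℕ → Set ℓ
  HasDegree p n = ¬ (coeff p n ≈ 0#) × (∀ i → n < i → coeff p i ≈ 0#)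

  Monic : Pol → Set ℓ
  Monic p = ∃ λ n → HasDegree p n × (coeff p n ≈ 1#)

  Irreducible : Pol → Set (c ⊔ ℓ)
  Irreducible p = (∃ λ n → HasDegree p (suc n))
                × (∀ a b → p ≃ a ⊗ b → HasDegree a 0 ⊎ HasDegree b 0)

  Squarefree : Pol → Set (c ⊔ ℓ)
  Squarefree p = ∀ d → d ⊗ d ∣ₚ p → HasDegree d 0

{-# OPTIONS --safe #-}
module Submission where

-- Let P₁, …, P_ω be the distinct monic irreducible factors of Q.  Euclid's lemma in F[z]
-- (from division with remainder) makes each Pᵢ divide Q / (P₁ ⋯ Pᵢ₋₁), so Σ deg Pᵢ ≤ n.
-- A monic polynomial of degree ≤ m is fixed by its first m coefficients and one bit, so at
-- most 2qᵐ of the Pᵢ have degree ≤ m.  Choose m with q²ᵐ < n ≤ q²⁽ᵐ⁺¹⁾ and put s = qᵐ.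
-- Every factor of degree > m has n ≤ q^(2 deg Pᵢ), so these contribute at most q²ⁿ to n^ω;
-- the at most 2s others contribute n²ˢ ≤ 4ⁿ ≤ q²ⁿ, since n^s ≤ 2ⁿ whenever s² < n.

open import Defs
open import Data.Nat using (ℕ; suc; _≤_; _<_; _*_; _^_)
open import Data.Nat.Primality using (Prime)
open import Data.List using (List; length)
open import Data.List.Relation.Unary.All using (All)
open import Data.List.Relation.Unary.AllPairs using (AllPairs)
open import Data.Product using (∃; _×_)
open import Relation.Binary.PropositionalEquality using (_≡_)
open import Relation.Nullary using (¬_)

open import Level using (_⊔_)
open import Data.Nat as ℕ using (zero; z≤n; s≤s; z<s; _≤?_)
import Data.Nat.Properties as ℕ
import Data.Nat.Induction as ℕ
open import Data.Nat.Primality using (prime⇒nonTrivial)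
open import Data.Nat.ListAction using (sum)
open import Data.List using ([]; _∷_; map; lookup; filter)
open import Data.List.Properties using (length-map)
open import Data.List.Membership.Propositional.Properties using (∈-lookup)
open import Data.List.Relation.Unary.All as All using ([]; _∷_)
import Data.List.Relation.Unary.All.Properties as All
open import Data.List.Relation.Unary.AllPairs using ([]; _∷_)
import Data.List.Relation.Unary.AllPairs.Properties as AllPairs
open import Data.Fin using (Fin)
import Data.Fin as Fin
import Data.Fin.Properties as Fin
open import Data.Product using (_,_; proj₁; proj₂; map₂)
open import Data.Sum using (_⊎_; inj₁; inj₂)
open import Relation.Binary.PropositionalEquality as ≡ using (_≢_)
open import Relation.Nullary using (Dec; yes; no; contradiction)
open import Relation.Nullary.Decidable using (map′)
open import Relation.Binary.Definitions using (Decidable; tri<; tri≈; tri>)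
open import Relation.Binary.Bundles using (Setoid)
open import Relation.Binary.Structures using (IsEquivalence)
import Relation.Binary.Reasoning.Setoid as SetoidReasoning
open import Induction.WellFounded using (Acc; acc)
open import Algebra.Bundles using (AbelianGroup; CommutativeRing)

module Arithmetic where
  open import Data.Nat using (_+_; NonZero; >-nonZero)
  open import Data.Nat.Properties
  open import Data.Nat.Tactic.RingSolver using (solve-∀)
  open import Data.Unit using (tt)
  open import Relation.Binary.PropositionalEquality using (refl; sym; trans; cong; cong₂; subst)
  import Relation.Unary as U
  open import Algebra.Properties.CommutativeSemigroup *-commutativeSemigroup
    using (xy∙z≈y∙xz; xy∙z≈xz∙y; x∙yz≈y∙xz; interchange)
  open ≤-Reasoning

  -- (1 + 1/n)^j ≤ n/(n − j), with n = j + t and denominators cleared.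
  [1+j+t]^j*t≤[j+t]^[1+j] : ∀ j t → suc (j + t) ^ j * t ≤ (j + t) ^ suc j
  [1+j+t]^j*t≤[j+t]^[1+j] zero    t = ≤-reflexive (trans (+-identityʳ t) (sym (*-identityʳ t)))
  [1+j+t]^j*t≤[j+t]^[1+j] (suc j) t = begin
    suc n ^ suc j * t         ≡⟨ xy∙z≈y∙xz (suc n) (suc n ^ j) t ⟩
    suc n ^ j * (suc n * t)   ≤⟨ *-monoʳ-≤ (suc n ^ j) (+-monoˡ-≤ (n * t) t≤n) ⟩
    suc n ^ j * (n + n * t)   ≡⟨ cong (suc n ^ j *_) (trans (sym (*-suc n t)) (*-comm n (suc t))) ⟩
    suc n ^ j * (suc t * n)   ≡⟨ *-assoc (suc n ^ j) (suc t) n ⟨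
    suc n ^ j * suc t * n     ≤⟨ *-monoˡ-≤ n ih ⟩
    n ^ suc j * n             ≡⟨ *-comm (n ^ suc j) n ⟩
    n ^ suc (suc j)           ∎
    where
    n : ℕ
    n = suc j + t
    ih : suc n ^ j * suc t ≤ n ^ suc j
    ih = subst (λ m → suc m ^ j * suc t ≤ m ^ suc j) (+-suc j t) ([1+j+t]^j*t≤[j+t]^[1+j] j (suc t))
    t≤n : t ≤ n
    t≤n = m≤n+m t (suc j)

  [1+n]^s≤2*n^s : ∀ s {n} → 2 * s ≤ n → suc n ^ s ≤ 2 * n ^ s
  [1+n]^s≤2*n^s zero _ = s≤s z≤n
  [1+n]^s≤2*n^s s@(suc _) 2s≤n with t , refl ← m≤n⇒∃[o]m+o≡n (≤-trans (m≤m+n s (s + 0)) 2s≤n) =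
    *-cancelʳ-≤ _ _ t {{>-nonZero (≤-trans (s≤s z≤n) s≤t)}} (begin
      suc (s + t) ^ s * t      ≤⟨ [1+j+t]^j*t≤[j+t]^[1+j] s t ⟩
      (s + t) * (s + t) ^ s    ≤⟨ *-monoˡ-≤ ((s + t) ^ s) s+t≤2t ⟩
      2 * t * (s + t) ^ s      ≡⟨ xy∙z≈xz∙y 2 t _ ⟩
      2 * (s + t) ^ s * t      ∎)
    where
    s≤t : s ≤ t
    s≤t = ≤-trans (≤-reflexive (sym (+-identityʳ s))) (+-cancelˡ-≤ s (s + 0) t 2s≤n)
    s+t≤2t : s + t ≤ 2 * t
    s+t≤2t = subst (s + t ≤_) (cong (t +_) (sym (+-identityʳ t))) (+-monoˡ-≤ t s≤t)

  1+s*s≤2^s : ∀ k → let s = 5 + k in suc (s * s) ≤ 2 ^ s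
  1+s*s≤2^s zero    = ≤ᵇ⇒≤ 26 32 tt
  1+s*s≤2^s (suc k) = begin
    suc (suc s * suc s)          ≡⟨ expand s ⟩
    suc (s * s) + suc (2 * s)    ≤⟨ +-mono-≤ ih (≤-trans (s≤s 2s≤s*s) ih) ⟩
    2 ^ s + 2 ^ s                ≡⟨ cong (2 ^ s +_) (sym (+-identityʳ (2 ^ s))) ⟩
    2 ^ suc s                    ∎
    where
    s : ℕ
    s = 5 + k
    ih : suc (s * s) ≤ 2 ^ s
    ih = 1+s*s≤2^s k
    2s≤s*s : 2 * s ≤ s * s
    2s≤s*s = *-monoˡ-≤ s {2} {s} (s≤s (s≤s z≤n))
    expand : ∀ s → suc (suc s * suc s) ≡ suc (s * s) + suc (2 * s)
    expand = solve-∀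

  [1+s*s]^s≤2^[1+s*s] : ∀ s → suc (s * s) ^ s ≤ 2 ^ suc (s * s)
  [1+s*s]^s≤2^[1+s*s] 0 = ≤ᵇ⇒≤ _ _ tt
  [1+s*s]^s≤2^[1+s*s] 1 = ≤ᵇ⇒≤ _ _ tt
  [1+s*s]^s≤2^[1+s*s] 2 = ≤ᵇ⇒≤ _ _ tt
  [1+s*s]^s≤2^[1+s*s] 3 = ≤ᵇ⇒≤ _ _ tt
  [1+s*s]^s≤2^[1+s*s] 4 = ≤ᵇ⇒≤ _ _ tt
  [1+s*s]^s≤2^[1+s*s] s@(suc (suc (suc (suc (suc k))))) = begin
    suc (s * s) ^ s   ≤⟨ ^-monoˡ-≤ s (1+s*s≤2^s k) ⟩
    (2 ^ s) ^ s       ≡⟨ ^-*-assoc 2 s s ⟩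
    2 ^ (s * s)       ≤⟨ ^-monoʳ-≤ 2 (n≤1+n (s * s)) ⟩
    2 ^ suc (s * s)   ∎

  2*s≤1+s*s : ∀ s → 2 * s ≤ suc (s * s)
  2*s≤1+s*s zero    = z≤n
  2*s≤1+s*s (suc s) = subst (2 * suc s ≤_) (sym (expand s)) (m≤m+n (2 * suc s) (s * s))
    where
    expand : ∀ s → suc (suc s * suc s) ≡ 2 * suc s + s * s
    expand = solve-∀

  n^s≤2^n : ∀ {s n} → s * s < n → n ^ s ≤ 2 ^ n
  n^s≤2^n {s} s*s<n with k , refl ← m≤n⇒∃[o]m+o≡n s*s<n =
    subst (λ n → n ^ s ≤ 2 ^ n) (+-comm k (suc (s * s))) (from-base k)
    where
    from-base : ∀ k → (k + suc (s * s)) ^ s ≤ 2 ^ (k + suc (s * s))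
    from-base zero    = [1+s*s]^s≤2^[1+s*s] s
    from-base (suc k) = begin
      suc n ^ s    ≤⟨ [1+n]^s≤2*n^s s (≤-trans (2*s≤1+s*s s) (m≤n+m (suc (s * s)) k)) ⟩
      2 * n ^ s    ≤⟨ *-monoʳ-≤ 2 (from-base k) ⟩
      2 * 2 ^ n    ∎
      where
      n : ℕ
      n = k + suc (s * s)

  n<m^n : ∀ {m} → 1 < m → ∀ n → n < m ^ n
  n<m^n 1<m zero    = s≤s z≤n
  n<m^n 1<m (suc n) = ≤-<-trans (n<m^n 1<m n) (^-monoʳ-< _ 1<m (n<1+n n))

  ^-distribʳ-* : ∀ m n o → (m * n) ^ o ≡ m ^ o * n ^ o
  ^-distribʳ-* m n zero    = refl
  ^-distribʳ-* m n (suc o) = trans (cong (m * n *_) (^-distribʳ-* m n o)) (interchange m n (m ^ o) (n ^ o))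

  crossing-point : ∀ (f : ℕ → ℕ) {n} k → f 0 < n → n ≤ f k → ∃ λ m → f m < n × n ≤ f (suc m)
  crossing-point f zero    f0<n n≤f0 = contradiction n≤f0 (<⇒≱ f0<n)
  crossing-point f {n} (suc k) f0<n n≤f[1+k] with n ≤? f k
  ... | yes n≤fk = crossing-point f k f0<n n≤fk
  ... | no  n≰fk = k , ≰⇒> n≰fk , n≤f[1+k]

  module _ {a p} {A : Set a} (deg : A → ℕ) {P : U.Pred A p} (P? : U.Decidable P) where

    n^length-split : ∀ {n b} .{{_ : NonZero b}} → (∀ x → ¬ P x → n ≤ b ^ deg x) → ∀ xs →
                     n ^ length xs ≤ n ^ length (filter P? xs) * b ^ sum (map deg xs)
    n^length-split large [] = ≤-refl
    n^length-split {n} {b} large (x ∷ xs) with P? x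
    ... | yes _ = begin
      n * n ^ length xs             ≤⟨ *-monoʳ-≤ n (n^length-split large xs) ⟩
      n * (n ^ F * b ^ S)           ≡⟨ *-assoc n (n ^ F) (b ^ S) ⟨
      n * n ^ F * b ^ S             ≤⟨ *-monoʳ-≤ (n * n ^ F) (^-monoʳ-≤ b (m≤n+m S (deg x))) ⟩
      n * n ^ F * b ^ (deg x + S)   ∎
      where
      F S : ℕ
      F = length (filter P? xs)
      S = sum (map deg xs)
    ... | no ¬Px = begin
      n * n ^ length xs             ≤⟨ *-mono-≤ (large x ¬Px) (n^length-split large xs) ⟩
      b ^ deg x * (n ^ F * b ^ S)   ≡⟨ x∙yz≈y∙xz (b ^ deg x) (n ^ F) (b ^ S) ⟩
      n ^ F * (b ^ deg x * b ^ S)   ≡⟨ cong (n ^ F *_) (^-distribˡ-+-* b (deg x) S) ⟨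
      n ^ F * b ^ (deg x + S)       ∎
      where
      F S : ℕ
      F = length (filter P? xs)
      S = sum (map deg xs)

  m^[2*n]≡m^n*m^n : ∀ m n → m ^ (2 * n) ≡ m ^ n * m ^ n
  m^[2*n]≡m^n*m^n m n = trans (cong (λ k → m ^ (n + k)) (+-identityʳ n)) (^-distribˡ-+-* m n n)

  n^length≤q^[4*n] : ∀ {a} {A : Set a} (deg : A → ℕ) {q n} → 2 ≤ q → 1 < n → ∀ xs →
                      sum (map deg xs) ≤ n → (∀ m → length (filter (λ x → deg x ≤? m) xs) ≤ 2 * q ^ m) →
                      n ^ length xs ≤ q ^ (4 * n)
  n^length≤q^[4*n] deg {q} {n} 2≤q@(s≤s (s≤s _)) 1<n@(s≤s (s≤s _)) xs total≤n low-count
    with m , [q*q]^m<n , n≤[q*q]^[1+m] ←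
           crossing-point ((q * q) ^_) n 1<n (<⇒≤ (n<m^n (≤-trans 2≤q (m≤m*n q q)) n)) = begin
    n ^ length xs                       ≤⟨ n^length-split deg (λ x → deg x ≤? m) high xs ⟩
    n ^ length low * (q * q) ^ total    ≤⟨ *-mono-≤ (^-monoʳ-≤ n (low-count m)) (^-monoʳ-≤ (q * q) total≤n) ⟩
    n ^ (2 * s) * (q * q) ^ n           ≡⟨ cong₂ _*_ (m^[2*n]≡m^n*m^n n s) (^-distribʳ-* q q n) ⟩
    n ^ s * n ^ s * (q ^ n * q ^ n)     ≤⟨ *-monoˡ-≤ (q ^ n * q ^ n) (*-mono-≤ n^s≤q^n n^s≤q^n) ⟩
    q ^ n * q ^ n * (q ^ n * q ^ n)     ≡⟨ cong₂ _*_ (m^[2*n]≡m^n*m^n q n) (m^[2*n]≡m^n*m^n q n) ⟨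
    q ^ (2 * n) * q ^ (2 * n)           ≡⟨ m^[2*n]≡m^n*m^n q (2 * n) ⟨
    q ^ (2 * (2 * n))                   ≡⟨ cong (q ^_) (*-assoc 2 2 n) ⟨
    q ^ (4 * n)                         ∎
    where
    s total : ℕ
    s = q ^ m
    total = sum (map deg xs)
    low : List _
    low = filter (λ x → deg x ≤? m) xs
    high : ∀ x → ¬ deg x ≤ m → n ≤ (q * q) ^ deg x
    high x d≰m = ≤-trans n≤[q*q]^[1+m] (^-monoʳ-≤ (q * q) (≰⇒> d≰m))
    n^s≤q^n : n ^ s ≤ q ^ n
    n^s≤q^n = ≤-trans (n^s≤2^n {s} (subst (_< n) (^-distribʳ-* q q m) [q*q]^m<n)) (^-monoˡ-≤ n 2≤q)

lookup-injective : ∀ {a} {A : Set a} {xs : List A} → AllPairs _≢_ xs →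
                   ∀ {i j} → lookup xs i ≡ lookup xs j → i ≡ j
lookup-injective (_   ∷ _)        {Fin.zero}  {Fin.zero}  _  = ≡.refl
lookup-injective (x∉xs ∷ _)       {Fin.zero}  {Fin.suc j} eq = contradiction eq (All.lookup x∉xs (∈-lookup j))
lookup-injective (x∉xs ∷ _)       {Fin.suc i} {Fin.zero}  eq = contradiction (≡.sym eq) (All.lookup x∉xs (∈-lookup i))
lookup-injective (_    ∷ unique) {Fin.suc i} {Fin.suc j} eq = ≡.cong Fin.suc (lookup-injective unique eq)

distinct-length-≤ : ∀ {k} {xs : List (Fin k)} → AllPairs _≢_ xs → length xs ≤ k
distinct-length-≤ unique = Fin.injective⇒≤ (lookup-injective unique)

funToFin-injective : ∀ {m n} {f g : Fin m → Fin n} → Fin.funToFin f ≡ Fin.funToFin g → ∀ i → f i ≡ g i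
funToFin-injective {f = f} {g} eq i =
  ≡.trans (≡.sym (Fin.finToFun-funToFin f i))
          (≡.trans (≡.cong (λ k → Fin.finToFun k i) eq) (Fin.finToFun-funToFin g i))

module _ {c ℓ} (R : CommutativeRing c ℓ) where
  open CommutativeRing R renaming (_*_ to _·_)
  open import Algebra.Properties.Ring ring using ([y-z]x≈yx-zx)
  open import Algebra.Properties.AbelianGroup +-abelianGroup using (xyx⁻¹≈y)
  open import Algebra.Properties.CommutativeSemigroup.Divisibility *-commutativeSemigroup
    using (_∣_; _,_; ∣-respʳ-≈; x∣ʳy⇒x∣ʳzy)
  open SetoidReasoning setoid

  ∣-summand : ∀ {w x y z} → x ≈ y + z → w ∣ x → w ∣ y → w ∣ z
  ∣-summand {w} {x} {y} {z} x≈y+z (a , aw≈x) (b , bw≈y) = a - b , (begin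
    (a - b) · w      ≈⟨ [y-z]x≈yx-zx w a b ⟩
    a · w - b · w    ≈⟨ +-cong (trans aw≈x x≈y+z) (-‿cong bw≈y) ⟩
    y + z - y        ≈⟨ xyx⁻¹≈y y z ⟩
    z                ∎)

  ∣-remainder : ∀ {w x} {s d t} {y} → x ≈ s · d + t → w ∣ x · y → w ∣ d · y → w ∣ t · y
  ∣-remainder {w} {x} {s} {d} {t} {y} x≈sd+t w∣xy w∣dy =
    ∣-summand (trans (*-congʳ x≈sd+t) (distribʳ y (s · d) t))
              w∣xy (∣-respʳ-≈ (sym (*-assoc s d y)) (x∣ʳy⇒x∣ʳzy s w∣dy))

  ∣-cancel-unit : ∀ {u x y} → u ∣ 1# → x ∣ u · y → x ∣ y
  ∣-cancel-unit {u} {x} {y} (v , vu≈1) x∣uy = ∣-respʳ-≈ v[uy]≈y (x∣ʳy⇒x∣ʳzy v x∣uy)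
    where
    v[uy]≈y : v · (u · y) ≈ y
    v[uy]≈y = begin
      v · (u · y)   ≈⟨ *-assoc v u y ⟨
      v · u · y     ≈⟨ *-congʳ vu≈1 ⟩
      1# · y        ≈⟨ *-identityˡ y ⟩
      y             ∎

module Polynomials {c ℓ} (F : Field c ℓ) where
  open Field F hiding (zero) renaming (_*_ to _·_)
  open Poly F
  open import Algebra.Properties.Ring ring using (-0#≈0#)

  -- Wrapping _≃_ in a record lets Agda infer the polynomials from an equation between them.
  infix 4 _≋_
  record _≋_ (p r : Pol) : Set ℓ where
    constructor coeffwise
    field ≋⇒≃ : p ≃ r
  open _≋_ public

  ≋-isEquivalence : IsEquivalence _≋_
  ≋-isEquivalence = record
    { refl  = coeffwise λ _ → refl
    ; sym   = λ p≋r → coeffwise λ i → sym (≋⇒≃ p≋r i)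
    ; trans = λ p≋r r≋s → coeffwise λ i → trans (≋⇒≃ p≋r i) (≋⇒≃ r≋s i)
    }

  ≋-setoid : Setoid c ℓ
  ≋-setoid = record { isEquivalence = ≋-isEquivalence }

  open Setoid ≋-setoid public using () renaming (refl to ≋-refl; sym to ≋-sym; trans to ≋-trans)
  module ≋-Reasoning = SetoidReasoning ≋-setoid
  module ≈-Reasoning = SetoidReasoning setoid

  negate : Pol → Pol
  negate = map (λ a → - a)

  coeff-⊕ : ∀ p r i → coeff (p ⊕ r) i ≈ coeff p i + coeff r i
  coeff-⊕ []      r       i       = sym (+-identityˡ _)
  coeff-⊕ (a ∷ p) []      i       = sym (+-identityʳ _)
  coeff-⊕ (a ∷ p) (b ∷ r) zero    = refl
  coeff-⊕ (a ∷ p) (b ∷ r) (suc i) = coeff-⊕ p r i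

  coeff-scale : ∀ a p i → coeff (scale a p) i ≈ a · coeff p i
  coeff-scale a []      i       = sym (zeroʳ a)
  coeff-scale a (b ∷ p) zero    = refl
  coeff-scale a (b ∷ p) (suc i) = coeff-scale a p i

  coeff-negate : ∀ p i → coeff (negate p) i ≈ - coeff p i
  coeff-negate []      i       = sym -0#≈0#
  coeff-negate (a ∷ p) zero    = refl
  coeff-negate (a ∷ p) (suc i) = coeff-negate p i

  coeff-⊕-negate : ∀ p r i → coeff (p ⊕ negate r) i ≈ coeff p i - coeff r i
  coeff-⊕-negate p r i = trans (coeff-⊕ p (negate r) i) (+-congˡ (coeff-negate r i))

  ∷-cong : ∀ {a b p r} → a ≈ b → p ≋ r → a ∷ p ≋ b ∷ r
  ∷-cong a≈b p≋r = coeffwise λ { zero → a≈b ; (suc i) → ≋⇒≃ p≋r i }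

  0∷-≋[] : ∀ {p} → p ≋ [] → 0# ∷ p ≋ []
  0∷-≋[] p≋[] = coeffwise λ { zero → refl ; (suc i) → ≋⇒≃ p≋[] i }

  ⊕-cong : ∀ {p p' r r'} → p ≋ p' → r ≋ r' → p ⊕ r ≋ p' ⊕ r'
  ⊕-cong {p} {p'} {r} {r'} p≋p' r≋r' = coeffwise λ i → begin
    coeff (p ⊕ r) i           ≈⟨ coeff-⊕ p r i ⟩
    coeff p i + coeff r i     ≈⟨ +-cong (≋⇒≃ p≋p' i) (≋⇒≃ r≋r' i) ⟩
    coeff p' i + coeff r' i   ≈⟨ coeff-⊕ p' r' i ⟨
    coeff (p' ⊕ r') i         ∎
    where open ≈-Reasoning

  ⊕-assoc : ∀ p r s → (p ⊕ r) ⊕ s ≋ p ⊕ (r ⊕ s)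
  ⊕-assoc p r s = coeffwise λ i → begin
    coeff ((p ⊕ r) ⊕ s) i                 ≈⟨ trans (coeff-⊕ (p ⊕ r) s i) (+-congʳ (coeff-⊕ p r i)) ⟩
    (coeff p i + coeff r i) + coeff s i   ≈⟨ +-assoc _ _ _ ⟩
    coeff p i + (coeff r i + coeff s i)   ≈⟨ trans (coeff-⊕ p (r ⊕ s) i) (+-congˡ (coeff-⊕ r s i)) ⟨
    coeff (p ⊕ (r ⊕ s)) i                 ∎
    where open ≈-Reasoning

  ⊕-comm : ∀ p r → p ⊕ r ≋ r ⊕ p
  ⊕-comm p r = coeffwise λ i → trans (coeff-⊕ p r i) (trans (+-comm _ _) (sym (coeff-⊕ r p i)))

  ⊕-identityʳ : ∀ p → p ⊕ [] ≋ p
  ⊕-identityʳ p = coeffwise λ i → trans (coeff-⊕ p [] i) (+-identityʳ _)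

  ⊕-≋[]ʳ : ∀ {p r} → r ≋ [] → p ⊕ r ≋ p
  ⊕-≋[]ʳ {p} {r} r≋[] = coeffwise λ i → trans (coeff-⊕ p r i) (trans (+-congˡ (≋⇒≃ r≋[] i)) (+-identityʳ _))

  ⊕-inverseˡ : ∀ p → negate p ⊕ p ≋ []
  ⊕-inverseˡ p = coeffwise λ i →
    trans (coeff-⊕ (negate p) p i) (trans (+-congʳ (coeff-negate p i)) (-‿inverseˡ _))

  negate-cong : ∀ {p r} → p ≋ r → negate p ≋ negate r
  negate-cong {p} {r} p≋r = coeffwise λ i →
    trans (coeff-negate p i) (trans (-‿cong (≋⇒≃ p≋r i)) (sym (coeff-negate r i)))

  ⊕-abelianGroup : AbelianGroup c ℓ
  ⊕-abelianGroup = record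
    { Carrier = Pol ; _≈_ = _≋_ ; _∙_ = _⊕_ ; ε = [] ; _⁻¹ = negate
    ; isAbelianGroup = record
      { isGroup = record
        { isMonoid = record
          { isSemigroup = record
            { isMagma = record { isEquivalence = ≋-isEquivalence ; ∙-cong = ⊕-cong }
            ; assoc = ⊕-assoc }
          ; identity = (λ _ → ≋-refl) , ⊕-identityʳ }
        ; inverse = ⊕-inverseˡ , λ p → ≋-trans (⊕-comm p (negate p)) (⊕-inverseˡ p)
        ; ⁻¹-cong = negate-cong }
      ; comm = ⊕-comm } }

  open import Algebra.Properties.CommutativeSemigroup (AbelianGroup.commutativeSemigroup ⊕-abelianGroup)
    using (interchange; x∙yz≈y∙xz; xy∙z≈xz∙y)
  open import Algebra.Properties.Group (AbelianGroup.group ⊕-abelianGroup) using (//-rightDividesˡ)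

  scale-cong : ∀ {a b p r} → a ≈ b → p ≋ r → scale a p ≋ scale b r
  scale-cong {a} {b} {p} {r} a≈b p≋r = coeffwise λ i →
    trans (coeff-scale a p i) (trans (*-cong a≈b (≋⇒≃ p≋r i)) (sym (coeff-scale b r i)))

  scale-zeroˡ : ∀ p → scale 0# p ≋ []
  scale-zeroˡ p = coeffwise λ i → trans (coeff-scale 0# p i) (zeroˡ _)

  scale-identityˡ : ∀ p → scale 1# p ≋ p
  scale-identityˡ p = coeffwise λ i → trans (coeff-scale 1# p i) (*-identityˡ _)

  scale-* : ∀ a b p → scale (a · b) p ≋ scale a (scale b p)
  scale-* a b p = coeffwise λ i → begin
    coeff (scale (a · b) p) i     ≈⟨ trans (coeff-scale (a · b) p i) (*-assoc a b _) ⟩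
    a · (b · coeff p i)           ≈⟨ trans (coeff-scale a (scale b p) i) (*-congˡ (coeff-scale b p i)) ⟨
    coeff (scale a (scale b p)) i ∎
    where open ≈-Reasoning

  scale-distribˡ : ∀ a p r → scale a (p ⊕ r) ≋ scale a p ⊕ scale a r
  scale-distribˡ a p r = coeffwise λ i → begin
    coeff (scale a (p ⊕ r)) i                 ≈⟨ trans (coeff-scale a (p ⊕ r) i) (*-congˡ (coeff-⊕ p r i)) ⟩
    a · (coeff p i + coeff r i)               ≈⟨ distribˡ a _ _ ⟩
    a · coeff p i + a · coeff r i             ≈⟨ trans (coeff-⊕ (scale a p) (scale a r) i)
                                                       (+-cong (coeff-scale a p i) (coeff-scale a r i)) ⟨
    coeff (scale a p ⊕ scale a r) i           ∎
    where open ≈-Reasoning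

  ⊗-zeroʳ : ∀ p → p ⊗ [] ≋ []
  ⊗-zeroʳ []      = ≋-refl
  ⊗-zeroʳ (a ∷ p) = 0∷-≋[] (⊗-zeroʳ p)

  ⊗-congʳ : ∀ p {r r'} → r ≋ r' → p ⊗ r ≋ p ⊗ r'
  ⊗-congʳ []      r≋r' = ≋-refl
  ⊗-congʳ (a ∷ p) r≋r' = ⊕-cong (scale-cong refl r≋r') (∷-cong refl (⊗-congʳ p r≋r'))

  ⊗-∷ʳ : ∀ p a r → p ⊗ (a ∷ r) ≋ scale a p ⊕ (0# ∷ p ⊗ r)
  ⊗-∷ʳ []      a r = ≋-sym (0∷-≋[] ≋-refl)
  ⊗-∷ʳ (b ∷ p) a r = ∷-cong (+-congʳ (*-comm b a)) (begin
    scale b r ⊕ p ⊗ (a ∷ r)                   ≈⟨ ⊕-cong ≋-refl (⊗-∷ʳ p a r) ⟩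
    scale b r ⊕ (scale a p ⊕ (0# ∷ p ⊗ r))    ≈⟨ x∙yz≈y∙xz (scale b r) (scale a p) _ ⟩
    scale a p ⊕ (scale b r ⊕ (0# ∷ p ⊗ r))    ∎)
    where open ≋-Reasoning

  ⊗-comm : ∀ p r → p ⊗ r ≋ r ⊗ p
  ⊗-comm []      r = ≋-sym (⊗-zeroʳ r)
  ⊗-comm (a ∷ p) r = ≋-trans (⊕-cong ≋-refl (∷-cong refl (⊗-comm p r))) (≋-sym (⊗-∷ʳ r a p))

  ⊗-distribˡ : ∀ p r s → p ⊗ (r ⊕ s) ≋ p ⊗ r ⊕ p ⊗ s
  ⊗-distribˡ []      r s = ≋-refl
  ⊗-distribˡ (a ∷ p) r s = begin
    scale a (r ⊕ s) ⊕ (0# ∷ p ⊗ (r ⊕ s))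
      ≈⟨ ⊕-cong (scale-distribˡ a r s) (∷-cong (sym (+-identityʳ 0#)) (⊗-distribˡ p r s)) ⟩
    (scale a r ⊕ scale a s) ⊕ ((0# ∷ p ⊗ r) ⊕ (0# ∷ p ⊗ s))
      ≈⟨ interchange (scale a r) (scale a s) _ _ ⟩
    (scale a r ⊕ (0# ∷ p ⊗ r)) ⊕ (scale a s ⊕ (0# ∷ p ⊗ s)) ∎
    where open ≋-Reasoning

  ⊗-congˡ : ∀ {p p'} r → p ≋ p' → p ⊗ r ≋ p' ⊗ r
  ⊗-congˡ {p} {p'} r p≋p' = ≋-trans (⊗-comm p r) (≋-trans (⊗-congʳ r p≋p') (⊗-comm r p'))

  ⊗-cong : ∀ {p p' r r'} → p ≋ p' → r ≋ r' → p ⊗ r ≋ p' ⊗ r'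
  ⊗-cong {p' = p'} {r} p≋p' r≋r' = ≋-trans (⊗-congˡ r p≋p') (⊗-congʳ p' r≋r')

  ⊗-distribʳ : ∀ p r s → (r ⊕ s) ⊗ p ≋ r ⊗ p ⊕ s ⊗ p
  ⊗-distribʳ p r s =
    ≋-trans (⊗-comm (r ⊕ s) p) (≋-trans (⊗-distribˡ p r s) (⊕-cong (⊗-comm p r) (⊗-comm p s)))

  scale-⊗ : ∀ a p r → scale a p ⊗ r ≋ scale a (p ⊗ r)
  scale-⊗ a []      r = ≋-refl
  scale-⊗ a (b ∷ p) r = begin
    scale (a · b) r ⊕ (0# ∷ scale a p ⊗ r)
      ≈⟨ ⊕-cong (scale-* a b r) (∷-cong (sym (zeroʳ a)) (scale-⊗ a p r)) ⟩
    scale a (scale b r) ⊕ scale a (0# ∷ p ⊗ r)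
      ≈⟨ scale-distribˡ a (scale b r) (0# ∷ p ⊗ r) ⟨
    scale a (scale b r ⊕ (0# ∷ p ⊗ r)) ∎
    where open ≋-Reasoning

  0∷-⊗ : ∀ p r → (0# ∷ p) ⊗ r ≋ 0# ∷ p ⊗ r
  0∷-⊗ p r = ⊕-cong (scale-zeroˡ r) ≋-refl

  ⊗-assoc : ∀ p r s → (p ⊗ r) ⊗ s ≋ p ⊗ (r ⊗ s)
  ⊗-assoc []      r s = ≋-refl
  ⊗-assoc (a ∷ p) r s = begin
    (scale a r ⊕ (0# ∷ p ⊗ r)) ⊗ s              ≈⟨ ⊗-distribʳ s (scale a r) (0# ∷ p ⊗ r) ⟩
    scale a r ⊗ s ⊕ (0# ∷ p ⊗ r) ⊗ s            ≈⟨ ⊕-cong (scale-⊗ a r s) (0∷-⊗ (p ⊗ r) s) ⟩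
    scale a (r ⊗ s) ⊕ (0# ∷ (p ⊗ r) ⊗ s)        ≈⟨ ⊕-cong ≋-refl (∷-cong refl (⊗-assoc p r s)) ⟩
    scale a (r ⊗ s) ⊕ (0# ∷ p ⊗ (r ⊗ s))        ∎
    where open ≋-Reasoning

  ⊗-identityˡ : ∀ p → (1# ∷ []) ⊗ p ≋ p
  ⊗-identityˡ p = ≋-trans (⊕-cong (scale-identityˡ p) (0∷-≋[] ≋-refl)) (⊕-identityʳ p)

  polynomialRing : CommutativeRing c ℓ
  polynomialRing = record
    { Carrier = Pol ; _≈_ = _≋_ ; _+_ = _⊕_ ; _*_ = _⊗_ ; -_ = negate ; 0# = [] ; 1# = 1# ∷ []
    ; isCommutativeRing = record
      { isRing = record
        { +-isAbelianGroup = AbelianGroup.isAbelianGroup ⊕-abelianGroup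
        ; *-cong = ⊗-cong
        ; *-assoc = ⊗-assoc
        ; *-identity = ⊗-identityˡ , λ p → ≋-trans (⊗-comm p _) (⊗-identityˡ p)
        ; distrib = ⊗-distribˡ , ⊗-distribʳ }
      ; *-comm = ⊗-comm } }

  module F[z] = CommutativeRing polynomialRing

  open import Algebra.Properties.CommutativeSemigroup.Divisibility F[z].*-commutativeSemigroup
    using (_∣_; _,_; ∣-respʳ-≈; x∣xy)

  ∣ₚ⇒∣ : ∀ {p r} → p ∣ₚ r → p ∣ r
  ∣ₚ⇒∣ {p} (s , r≃p⊗s) = s , ≋-trans (⊗-comm s p) (≋-sym (coeffwise r≃p⊗s))

  DegreeBelow : Pol → ℕ → Set ℓ
  DegreeBelow p N = ∀ i → N ≤ i → coeff p i ≈ 0#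

  DegreeBelow-mono : ∀ {p M N} → M ≤ N → DegreeBelow p M → DegreeBelow p N
  DegreeBelow-mono M≤N p<M i N≤i = p<M i (ℕ.≤-trans M≤N N≤i)

  DegreeBelow-length : ∀ p → DegreeBelow p (length p)
  DegreeBelow-length []      i       _         = refl
  DegreeBelow-length (a ∷ p) (suc i) (s≤s p≤i) = DegreeBelow-length p i p≤i

  DegreeBelow-tail : ∀ {a p N} → DegreeBelow (a ∷ p) (suc N) → DegreeBelow p N
  DegreeBelow-tail ap<N+1 i N≤i = ap<N+1 (suc i) (s≤s N≤i)

  DegreeBelow-0⇒≋[] : ∀ {p} → DegreeBelow p 0 → p ≋ []
  DegreeBelow-0⇒≋[] p<0 = coeffwise λ i → p<0 i z≤n

  HasDegree-resp-≋ : ∀ {p r d} → p ≋ r → HasDegree p d → HasDegree r d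
  HasDegree-resp-≋ p≋r (lead≉0 , p<d+1) =
    (λ lead≈0 → lead≉0 (trans (≋⇒≃ p≋r _) lead≈0)) , λ i d<i → trans (sym (≋⇒≃ p≋r i)) (p<d+1 i d<i)

  HasDegree⇒< : ∀ {p N d} → DegreeBelow p N → HasDegree p d → d < N
  HasDegree⇒< {N = N} {d} p<N (lead≉0 , _) with N ℕ.≤? d
  ... | yes N≤d = contradiction (p<N d N≤d) lead≉0
  ... | no  N≰d = ℕ.≰⇒> N≰d

  HasDegree-unique : ∀ {p a b} → HasDegree p a → HasDegree p b → a ≡ b
  HasDegree-unique {p} p°a p°b =
    ℕ.≤-antisym (ℕ.≤-pred (HasDegree⇒< {p} (proj₂ p°b) p°a)) (ℕ.≤-pred (HasDegree⇒< {p} (proj₂ p°a) p°b))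

  HasDegree⇒≉[] : ∀ {p d} → HasDegree p d → ¬ p ≋ []
  HasDegree⇒≉[] {d = d} (lead≉0 , _) p≋[] = lead≉0 (≋⇒≃ p≋[] d)

  HasDegree-0⇒≋constant : ∀ {p} → HasDegree p 0 → p ≋ coeff p 0 ∷ []
  HasDegree-0⇒≋constant (_ , p<1) = coeffwise λ { zero → refl ; (suc i) → p<1 (suc i) (s≤s z≤n) }

  *-≉0 : ∀ {x y} → ¬ x ≈ 0# → ¬ y ≈ 0# → ¬ x · y ≈ 0#
  *-≉0 {x} {y} x≉0 y≉0 xy≈0 with inverse y y≉0
  ... | y⁻¹ , yy⁻¹≈1 = x≉0 (begin
    x               ≈⟨ trans (*-congˡ yy⁻¹≈1) (*-identityʳ x) ⟨
    x · (y · y⁻¹)   ≈⟨ *-assoc x y y⁻¹ ⟨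
    x · y · y⁻¹     ≈⟨ trans (*-congʳ xy≈0) (zeroˡ y⁻¹) ⟩
    0#              ∎)
    where open ≈-Reasoning

  coeff-∷-⊗ : ∀ a p r i → coeff ((a ∷ p) ⊗ r) i ≈ a · coeff r i + coeff (0# ∷ p ⊗ r) i
  coeff-∷-⊗ a p r i = trans (coeff-⊕ (scale a r) (0# ∷ p ⊗ r) i) (+-congʳ (coeff-scale a r i))

  private
    x·0+0≈0 : ∀ {x y z} → y ≈ 0# → z ≈ 0# → x · y + z ≈ 0#
    x·0+0≈0 {x} y≈0 z≈0 = trans (+-cong (trans (*-congˡ y≈0) (zeroʳ x)) z≈0) (+-identityʳ 0#)

  ⊗-DegreeBelow : ∀ p r a b → DegreeBelow p (suc a) → DegreeBelow r (suc b) →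
                  DegreeBelow (p ⊗ r) (suc (a ℕ.+ b))
  ⊗-DegreeBelow []      r a       b _   _   _       _ = refl
  ⊗-DegreeBelow (x ∷ p) r zero    b p<1 r<b i b<i =
    trans (coeff-∷-⊗ x p r i) (x·0+0≈0 (r<b i b<i) (≋⇒≃ (0∷-≋[] p⊗r≋[]) i))
    where
    p⊗r≋[] : p ⊗ r ≋ []
    p⊗r≋[] = ⊗-congˡ r (DegreeBelow-0⇒≋[] {p} (DegreeBelow-tail {x} {p} p<1))
  ⊗-DegreeBelow (x ∷ p) r (suc a) b p<a r<b (suc i) (s≤s a+b<i) =
    trans (coeff-∷-⊗ x p r (suc i))
          (x·0+0≈0 (r<b (suc i) (s≤s (ℕ.≤-trans (ℕ.m≤n+m b a) (ℕ.<⇒≤ a+b<i))))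
                   (⊗-DegreeBelow p r a b (DegreeBelow-tail {x} {p} p<a) r<b i a+b<i))

  coeff-⊗-leading : ∀ p r a b → DegreeBelow p (suc a) → DegreeBelow r (suc b) →
                    coeff (p ⊗ r) (a ℕ.+ b) ≈ coeff p a · coeff r b
  coeff-⊗-leading []      r a       b _   _   = sym (zeroˡ _)
  coeff-⊗-leading (x ∷ p) r zero    b p<1 r<b =
    trans (coeff-∷-⊗ x p r b) (trans (+-congˡ (≋⇒≃ (0∷-≋[] p⊗r≋[]) b)) (+-identityʳ _))
    where
    p⊗r≋[] : p ⊗ r ≋ []
    p⊗r≋[] = ⊗-congˡ r (DegreeBelow-0⇒≋[] {p} (DegreeBelow-tail {x} {p} p<1))
  coeff-⊗-leading (x ∷ p) r (suc a) b p<a r<b =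
    trans (coeff-∷-⊗ x p r (suc (a ℕ.+ b)))
          (trans (+-congʳ (trans (*-congˡ (r<b _ (s≤s (ℕ.m≤n+m b a)))) (zeroʳ x)))
                 (trans (+-identityˡ _) (coeff-⊗-leading p r a b (DegreeBelow-tail {x} {p} p<a) r<b)))

  HasDegree-⊗ : ∀ {p r a b} → HasDegree p a → HasDegree r b → HasDegree (p ⊗ r) (a ℕ.+ b)
  HasDegree-⊗ {p} {r} {a} {b} (p-lead≉0 , p<a) (r-lead≉0 , r<b) =
    (λ lead≈0 → *-≉0 p-lead≉0 r-lead≉0 (trans (sym (coeff-⊗-leading p r a b p<a r<b)) lead≈0)) ,
    ⊗-DegreeBelow p r a b p<a r<b

  monomial : ℕ → Carrier → Pol
  monomial zero    a = a ∷ []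
  monomial (suc k) a = 0# ∷ monomial k a

  monomial-DegreeBelow : ∀ k a → DegreeBelow (monomial k a) (suc k)
  monomial-DegreeBelow zero    a (suc i) _         = refl
  monomial-DegreeBelow (suc k) a (suc i) (s≤s k<i) = monomial-DegreeBelow k a i k<i

  coeff-monomial : ∀ k a → coeff (monomial k a) k ≈ a
  coeff-monomial zero    a = refl
  coeff-monomial (suc k) a = coeff-monomial k a

  record Division (A D : Pol) (d : ℕ) : Set (c ⊔ ℓ) where
    field
      quotient remainder : Pol
      A≋qD+r             : A ≋ quotient ⊗ D ⊕ remainder
      remainder<d        : DegreeBelow remainder d

  module _ {D d} (D°d : HasDegree D d) where

    private
      lead⁻¹ : Carrier
      lead⁻¹ = proj₁ (inverse (coeff D d) (proj₁ D°d))

      lead*lead⁻¹≈1 : coeff D d · lead⁻¹ ≈ 1#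
      lead*lead⁻¹≈1 = proj₂ (inverse (coeff D d) (proj₁ D°d))

    leading-quotient : Pol → ℕ → Pol
    leading-quotient A N = monomial (N ℕ.∸ d) (coeff A N · lead⁻¹)

    leading-term-DegreeBelow : ∀ {A N} → d ≤ N → DegreeBelow (leading-quotient A N ⊗ D) (suc N)
    leading-term-DegreeBelow {A} {N} d≤N = ≡.subst (λ k → DegreeBelow (leading-quotient A N ⊗ D) (suc k))
      (ℕ.m∸n+n≡m d≤N)
      (⊗-DegreeBelow (leading-quotient A N) D (N ℕ.∸ d) d (monomial-DegreeBelow (N ℕ.∸ d) _) (proj₂ D°d))

    coeff-leading-term : ∀ {A N} → d ≤ N → coeff (leading-quotient A N ⊗ D) N ≈ coeff A N
    coeff-leading-term {A} {N} d≤N = ≡.subst (λ k → coeff (leading-quotient A N ⊗ D) k ≈ coeff A N)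
      (ℕ.m∸n+n≡m d≤N) (begin
        coeff (M ⊗ D) ((N ℕ.∸ d) ℕ.+ d)   ≈⟨ coeff-⊗-leading M D (N ℕ.∸ d) d
                                                (monomial-DegreeBelow (N ℕ.∸ d) _) (proj₂ D°d) ⟩
        coeff M (N ℕ.∸ d) · coeff D d     ≈⟨ *-congʳ (coeff-monomial (N ℕ.∸ d) _) ⟩
        coeff A N · lead⁻¹ · coeff D d    ≈⟨ *-assoc _ _ _ ⟩
        coeff A N · (lead⁻¹ · coeff D d)  ≈⟨ *-congˡ (trans (*-comm _ _) lead*lead⁻¹≈1) ⟩
        coeff A N · 1#                    ≈⟨ *-identityʳ _ ⟩
        coeff A N                         ∎)
      where
      M : Pol
      M = leading-quotient A N
      open ≈-Reasoning

    cancel-leading : ∀ {A N} → d ≤ N → DegreeBelow A (suc N) →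
                     DegreeBelow (A ⊕ negate (leading-quotient A N ⊗ D)) N
    cancel-leading {A} {N} d≤N A<N+1 i N≤i with ℕ.m≤n⇒m<n∨m≡n N≤i
    ... | inj₁ N<i = begin
      coeff (A ⊕ negate X) i   ≈⟨ coeff-⊕-negate A X i ⟩
      coeff A i - coeff X i    ≈⟨ +-cong (A<N+1 i N<i) (-‿cong (leading-term-DegreeBelow {A} d≤N i N<i)) ⟩
      0# - 0#                  ≈⟨ trans (+-congˡ -0#≈0#) (+-identityʳ 0#) ⟩
      0#                       ∎
      where
      X : Pol
      X = leading-quotient A N ⊗ D
      open ≈-Reasoning
    ... | inj₂ ≡.refl = begin
      coeff (A ⊕ negate X) N   ≈⟨ coeff-⊕-negate A X N ⟩
      coeff A N - coeff X N    ≈⟨ +-congˡ (-‿cong (coeff-leading-term {A} d≤N)) ⟩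
      coeff A N - coeff A N    ≈⟨ -‿inverseʳ (coeff A N) ⟩
      0#                       ∎
      where
      X : Pol
      X = leading-quotient A N ⊗ D
      open ≈-Reasoning

    divide-below : ∀ N A → DegreeBelow A N → Division A D d
    divide-below N A A<N with N ℕ.≤? d
    ... | yes N≤d = record
      { quotient = [] ; remainder = A ; A≋qD+r = ≋-refl ; remainder<d = DegreeBelow-mono {A} N≤d A<N }
    divide-below zero    A _     | no 0≰d   = contradiction z≤n 0≰d
    divide-below (suc N) A A<N+1 | no N+1≰d = record
      { quotient = quotient ⊕ M ; remainder = remainder ; A≋qD+r = A≋[q+M]D+r ; remainder<d = remainder<d }
      where
      M : Pol
      M = leading-quotient A N
      open Division (divide-below N (A ⊕ negate (M ⊗ D)) (cancel-leading {A} (ℕ.≤-pred (ℕ.≰⇒> N+1≰d)) A<N+1))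
      A≋[q+M]D+r : A ≋ (quotient ⊕ M) ⊗ D ⊕ remainder
      A≋[q+M]D+r = begin
        A                                     ≈⟨ //-rightDividesˡ (M ⊗ D) A ⟨
        (A ⊕ negate (M ⊗ D)) ⊕ M ⊗ D          ≈⟨ ⊕-cong A≋qD+r ≋-refl ⟩
        (quotient ⊗ D ⊕ remainder) ⊕ M ⊗ D    ≈⟨ xy∙z≈xz∙y (quotient ⊗ D) remainder (M ⊗ D) ⟩
        (quotient ⊗ D ⊕ M ⊗ D) ⊕ remainder    ≈⟨ ⊕-cong (⊗-distribʳ D quotient M) ≋-refl ⟨
        (quotient ⊕ M) ⊗ D ⊕ remainder        ∎
        where open ≋-Reasoning

    divide : ∀ A → Division A D d
    divide A = divide-below (length A) A (DegreeBelow-length A)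

  HasDegree-0⇒∣1 : ∀ {R} → HasDegree R 0 → R ∣ F[z].1#
  HasDegree-0⇒∣1 {R} R°0@(r≉0 , _) with inverse (coeff R 0) r≉0
  ... | r⁻¹ , rr⁻¹≈1 = r⁻¹ ∷ [] , ≋-trans (⊗-congʳ (r⁻¹ ∷ []) (HasDegree-0⇒≋constant R°0))
                                     (∷-cong (trans (+-identityʳ _) (trans (*-comm _ _) rr⁻¹≈1)) ≋-refl)

  monic-irreducible-∣⇒≋ : ∀ {P P'} → Monic P → Irreducible P → Monic P' → Irreducible P' →
                          P' ∣ P → P' ≋ P
  monic-irreducible-∣⇒≋ {P} {P'} (d , P°d , P-lead≈1) P-irr (d' , P'°d' , P'-lead≈1) P'-irr (S , S⊗P'≋P)
    with proj₂ P-irr S P' (≋⇒≃ (≋-sym S⊗P'≋P))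
  ... | inj₂ P'°0 = contradiction (HasDegree-unique {P'} P'°0 (proj₂ (proj₁ P'-irr))) λ ()
  ... | inj₁ S°0 = ≋-trans (≋-sym (⊗-identityˡ P')) (≋-trans (⊗-congˡ P' 1≋S) S⊗P'≋P)
    where
    d≡d' : d ≡ d'
    d≡d' = HasDegree-unique {P} P°d (HasDegree-resp-≋ S⊗P'≋P (HasDegree-⊗ {S} {P'} S°0 P'°d'))
    s≈1 : coeff S 0 ≈ 1#
    s≈1 = begin
      coeff S 0                   ≈⟨ trans (*-congˡ P'-lead≈1) (*-identityʳ _) ⟨
      coeff S 0 · coeff P' d'     ≈⟨ coeff-⊗-leading S P' 0 d' (proj₂ S°0) (proj₂ P'°d') ⟨
      coeff (S ⊗ P') d'           ≈⟨ ≋⇒≃ S⊗P'≋P d' ⟩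
      coeff P d'                  ≈⟨ ≡.subst (λ k → coeff P k ≈ 1#) d≡d' P-lead≈1 ⟩
      1#                          ∎
      where open ≈-Reasoning
    1≋S : 1# ∷ [] ≋ S
    1≋S = ≋-trans (∷-cong (sym s≈1) ≋-refl) (≋-sym (HasDegree-0⇒≋constant S°0))

  module DecidableCoefficients (_≈?_ : Decidable _≈_) where

    ≋[]⊎HasDegree : ∀ p → p ≋ [] ⊎ ∃ (HasDegree p)
    ≋[]⊎HasDegree []      = inj₁ ≋-refl
    ≋[]⊎HasDegree (a ∷ p) with ≋[]⊎HasDegree p
    ... | inj₂ (d , lead≉0 , p<d+1) = inj₂ (suc d , lead≉0 , λ { (suc i) (s≤s d<i) → p<d+1 i d<i })
    ... | inj₁ p≋[] with a ≈? 0#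
    ...   | yes a≈0 = inj₁ (coeffwise λ { zero → a≈0 ; (suc i) → ≋⇒≃ p≋[] i })
    ...   | no  a≉0 = inj₂ (0 , a≉0 , λ { (suc i) _ → ≋⇒≃ p≋[] i })

    -- The zero polynomial gets degree 0.
    deg : Pol → ℕ
    deg p with ≋[]⊎HasDegree p
    ... | inj₁ _       = 0
    ... | inj₂ (d , _) = d

    deg-≡ : ∀ {p d} → HasDegree p d → deg p ≡ d
    deg-≡ {p} p°d with ≋[]⊎HasDegree p
    ... | inj₁ p≋[]     = contradiction p≋[] (HasDegree⇒≉[] p°d)
    ... | inj₂ (e , p°e) = HasDegree-unique {p} p°e p°d

    module _ {P d} (P°d : HasDegree P d) (P-irr : Irreducible P) where

      irreducible-factor-degree : ∀ {S R e} → P ≋ S ⊗ R → HasDegree R e → e ≡ 0 ⊎ e ≡ d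
      irreducible-factor-degree {S} {R} P≋SR R°e with proj₂ P-irr S R (≋⇒≃ P≋SR)
      ... | inj₁ S°0 =
        inj₂ (HasDegree-unique {P} (HasDegree-resp-≋ (≋-sym P≋SR) (HasDegree-⊗ {S} {R} S°0 R°e)) P°d)
      ... | inj₂ R°0 = inj₁ (HasDegree-unique {R} R°e R°0)

      -- Dividing P by R leaves a remainder T of lower degree with P ∣ T ⊗ B; it is nonzero,
      -- since otherwise R would be a proper factor of P.
      ∣-cancel-lower-degree : ∀ {e} → Acc _<_ e → ∀ {R B} → HasDegree R e → e < d → P ∣ R ⊗ B → P ∣ B
      ∣-cancel-lower-degree {zero}  _         {R} R°0 _   P∣RB =
        ∣-cancel-unit polynomialRing {u = R} (HasDegree-0⇒∣1 {R} R°0) P∣RB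
      ∣-cancel-lower-degree {suc e} (acc rec) {R} {B} R°e e<d P∣RB with divide {R} R°e P
      ... | record { quotient = S ; remainder = T ; A≋qD+r = P≋SR+T ; remainder<d = T<e } with ≋[]⊎HasDegree T
      ...   | inj₂ (e' , T°e') = ∣-cancel-lower-degree (rec e'<e) {T} T°e' (ℕ.<-trans e'<e e<d)
                                  (∣-remainder polynomialRing {s = S} {R} {T} P≋SR+T (x∣xy P B) P∣RB)
        where
        e'<e : e' < suc e
        e'<e = HasDegree⇒< {T} T<e T°e'
      ...   | inj₁ T≋[] with irreducible-factor-degree {S} (≋-trans P≋SR+T (⊕-≋[]ʳ T≋[])) R°e
      ...     | inj₁ ()
      ...     | inj₂ ≡.refl = contradiction e<d (ℕ.<-irrefl ≡.refl)

      split-∣ : ∀ {A B} → P ∣ A ⊗ B → P ∣ A ⊎ P ∣ B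
      split-∣ {A} {B} P∣AB with divide P°d A
      ... | record { quotient = S ; remainder = T ; A≋qD+r = A≋SP+T ; remainder<d = T<d } with ≋[]⊎HasDegree T
      ...   | inj₁ T≋[] = inj₁ (S , ≋-sym (≋-trans A≋SP+T (⊕-≋[]ʳ T≋[])))
      ...   | inj₂ (e , T°e) = inj₂ (∣-cancel-lower-degree (ℕ.<-wellFounded e) {T} T°e (HasDegree⇒< {T} T<d T°e)
                                      (∣-remainder polynomialRing {s = S} {P} {T} A≋SP+T P∣AB (x∣xy P B)))

    sum-deg-≤ : ∀ {Q n} → HasDegree Q n → ∀ {Ps} → All (λ P → Monic P × Irreducible P × P ∣ Q) Ps →
                AllPairs (λ P R → ¬ P ≃ R) Ps → sum (map deg Ps) ≤ n
    sum-deg-≤ Q°n [] [] = z≤n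
    sum-deg-≤ {Q} {n} Q°n {P ∷ Ps} ((P-monic@(d , P°d , _) , P-irr , (S , S⊗P≋Q)) ∷ factors) (P≉Ps ∷ distinct)
      with ≋[]⊎HasDegree S
    ... | inj₁ S≋[] = contradiction (≋-trans (≋-sym S⊗P≋Q) (⊗-congˡ P S≋[])) (HasDegree⇒≉[] {Q} Q°n)
    ... | inj₂ (e , S°e) = begin
      deg P ℕ.+ sum (map deg Ps)  ≤⟨ ℕ.+-mono-≤ (ℕ.≤-reflexive (deg-≡ {P} P°d))
                                                (sum-deg-≤ S°e factors-of-S distinct) ⟩
      d ℕ.+ e                     ≡⟨ ℕ.+-comm d e ⟩
      e ℕ.+ d                     ≡⟨ HasDegree-unique {Q} (HasDegree-resp-≋ S⊗P≋Q (HasDegree-⊗ {S} {P} S°e P°d)) Q°n ⟩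
      n                           ∎
      where
      open ℕ.≤-Reasoning
      divides-S : ∀ {P'} → (Monic P' × Irreducible P' × P' ∣ Q) × ¬ P ≃ P' → Monic P' × Irreducible P' × P' ∣ S
      divides-S {P'} ((P'-monic , P'-irr@((_ , P'°) , _) , P'∣Q) , P≉P')
        with split-∣ P'° P'-irr (∣-respʳ-≈ (≋-sym S⊗P≋Q) P'∣Q)
      ... | inj₁ P'∣S = P'-monic , P'-irr , P'∣S
      ... | inj₂ P'∣P =
        contradiction (≋⇒≃ (≋-sym (monic-irreducible-∣⇒≋ P-monic P-irr P'-monic P'-irr P'∣P))) P≉P'
      factors-of-S : All (λ P' → Monic P' × Irreducible P' × P' ∣ S) Ps
      factors-of-S = All.zipWith divides-S (factors , P≉Ps)

  module FiniteField {q} (card : HasCardinality F q) where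
    open HasCardinality card

    index : Carrier → Fin q
    index x = proj₁ (enum-surj x)

    index-injective : ∀ {x y} → index x ≡ index y → x ≈ y
    index-injective {x} {y} eq =
      trans (sym (proj₂ (enum-surj x))) (trans (reflexive (≡.cong enum eq)) (proj₂ (enum-surj y)))

    index-cong : ∀ {x y} → x ≈ y → index x ≡ index y
    index-cong {x} {y} x≈y = enum-inj _ _ (trans (proj₂ (enum-surj x)) (trans x≈y (sym (proj₂ (enum-surj y)))))

    _≈?_ : Decidable _≈_
    x ≈? y = map′ index-injective index-cong (index x Fin.≟ index y)

    open DecidableCoefficients _≈?_ public

    bit : Carrier → Fin 2
    bit a with a ≈? 1#
    ... | yes _ = Fin.suc Fin.zero
    ... | no  _ = Fin.zero

    bit-injective : ∀ {a b} → a ≈ 1# ⊎ a ≈ 0# → b ≈ 1# ⊎ b ≈ 0# → bit a ≡ bit b → a ≈ b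
    bit-injective {a} {b} a∈01 b∈01 eq with a ≈? 1# | b ≈? 1#
    ... | yes a≈1 | yes b≈1 = trans a≈1 (sym b≈1)
    ... | yes _   | no  _   = contradiction eq λ ()
    ... | no  _   | yes _   = contradiction eq λ ()
    ... | no  a≉1 | no  b≉1 = trans (≉1⇒≈0 a∈01 a≉1) (sym (≉1⇒≈0 b∈01 b≉1))
      where
      ≉1⇒≈0 : ∀ {x} → x ≈ 1# ⊎ x ≈ 0# → ¬ x ≈ 1# → x ≈ 0#
      ≉1⇒≈0 (inj₁ x≈1) x≉1 = contradiction x≈1 x≉1
      ≉1⇒≈0 (inj₂ x≈0) _   = x≈0

    -- Such a polynomial is determined by its first m coefficients and whether its m-th one is 1.
    Encodable : ℕ → Pol → Set ℓ
    Encodable m p = DegreeBelow p (suc m) × (coeff p m ≈ 1# ⊎ coeff p m ≈ 0#)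

    code : (m : ℕ) → Pol → Fin (2 ℕ.* q ^ m)
    code m p = Fin.combine (bit (coeff p m)) (Fin.funToFin λ (i : Fin m) → index (coeff p (Fin.toℕ i)))

    code-injective : ∀ {m p r} → Encodable m p → Encodable m r → code m p ≡ code m r → p ≋ r
    code-injective {m} {p} {r} (p<m+1 , p-top) (r<m+1 , r-top) eq
      with bits≡ , digits≡ ← Fin.combine-injective _ _ _ _ eq = coeffwise coeff-≈
      where
      coeff-≈ : ∀ i → coeff p i ≈ coeff r i
      coeff-≈ i with ℕ.<-cmp i m
      ... | tri< i<m _ _ = ≡.subst (λ k → coeff p k ≈ coeff r k) (Fin.toℕ-fromℕ< i<m)
                             (index-injective (funToFin-injective digits≡ (Fin.fromℕ< i<m)))
      ... | tri≈ _ ≡.refl _ = bit-injective p-top r-top bits≡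
      ... | tri> _ _ m<i = trans (p<m+1 i m<i) (sym (r<m+1 i m<i))

    monic⇒encodable : ∀ {m p} → Monic p → deg p ≤ m → Encodable m p
    monic⇒encodable {m} {p} (d , p°d@(_ , p<d+1) , lead≈1) deg≤m =
      DegreeBelow-mono {p} (s≤s d≤m) p<d+1 , top (ℕ.m≤n⇒m<n∨m≡n d≤m)
      where
      d≤m : d ≤ m
      d≤m = ≡.subst (_≤ m) (deg-≡ {p} p°d) deg≤m
      top : d < m ⊎ d ≡ m → coeff p m ≈ 1# ⊎ coeff p m ≈ 0#
      top (inj₁ d<m)    = inj₂ (p<d+1 m d<m)
      top (inj₂ ≡.refl) = inj₁ lead≈1

    encodable-count : ∀ m {Ps} → All (Encodable m) Ps → AllPairs (λ P R → ¬ P ≃ R) Ps → length Ps ≤ 2 ℕ.* q ^ m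
    encodable-count m {Ps} encodable distinct = ≡.subst (_≤ 2 ℕ.* q ^ m) (length-map (code m) Ps)
      (distinct-length-≤ (AllPairs.map⁺ (codes-distinct encodable distinct)))
      where
      codes-distinct : ∀ {Ps} → All (Encodable m) Ps → AllPairs (λ P R → ¬ P ≃ R) Ps →
                       AllPairs (λ P R → code m P ≢ code m R) Ps
      codes-distinct []             []                = []
      codes-distinct {P ∷ _} (P-enc ∷ encs) (P≉Ps ∷ distinct) =
        All.zipWith (λ {R} (P≉R , R-enc) eq → P≉R (≋⇒≃ (code-injective {m} {P} {R} P-enc R-enc eq))) (P≉Ps , encs)
        ∷ codes-distinct encs distinct

    low-degree-count : ∀ m {Ps} → All Monic Ps → AllPairs (λ P R → ¬ P ≃ R) Ps →
                       length (filter (λ P → deg P ℕ.≤? m) Ps) ≤ 2 ℕ.* q ^ m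
    low-degree-count m {Ps} monic distinct = encodable-count m
      (All.zipWith (λ {P} (P-monic , P≤m) → monic⇒encodable {m} {P} P-monic P≤m)
                   (All.filter⁺ low? monic , All.all-filter low? Ps))
      (AllPairs.filter⁺ low? distinct)
      where
      low? : ∀ P → Dec (deg P ≤ m)
      low? P = deg P ℕ.≤? m

mainTheorem10 : ∀ {c ℓ} (q : ℕ) → (∃ λ p → ∃ λ k → Prime p × q ≡ p ^ suc k)
    → (F : Field c ℓ) → HasCardinality F q
    → let open Poly F in
      (Q : Pol) (n : ℕ) → 1 < n → HasDegree Q n → Squarefree Q
    → (Ps : List Pol)
    → All (λ P → Monic P × Irreducible P × P ∣ₚ Q) Ps
    → AllPairs (λ P R → ¬ (P ≃ R)) Ps
    → n ^ length Ps ≤ q ^ (4 * n)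
mainTheorem10 q (p , k , p-prime , q≡p^[1+k]) F card Q n 1<n Q°n _ Ps factors distinct =
  Arithmetic.n^length≤q^[4*n] deg 2≤q 1<n Ps
    (sum-deg-≤ {Q} Q°n (All.map (map₂ (map₂ ∣ₚ⇒∣)) factors) distinct)
    (λ m → low-degree-count m (All.map proj₁ factors) distinct)
  where
  open Polynomials F
  open FiniteField card
  2≤q : 2 ≤ q
  2≤q = ≡.subst (2 ≤_) (≡.sym q≡p^[1+k])
                 (ℕ.^-monoʳ-< p (ℕ.nonTrivial⇒n>1 p {{prime⇒nonTrivial p-prime}}) {0} {suc k} z<s)
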